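{- Let $k$ be a positive integer and $\mathbf S=(S_1,\dots,S_k)$ a $k$-tuple of indicators. Assume that (i) $S_1,\dots,S_k$ are connected and mutually rigid; (ii) there is an odd positive integer $g$ such that every $S_i$ has an oriented cycle of length $g$ and no shorter oriented cycle of odd length; and that for every $i\in[k]$: (iii) every vertex of $S_i$ is on an oriented cycle of length $g$; (iv) every bidirected path between $\mathrm{out}\,S_i$ and $\mathrm{in}\,S_i$ has length at least $3$; (v) every oriented path between $\mathrm{out}\,S_i$ and $\mathrm{in}\,S_i$ of odd length has length at least $g$. Then the categories $k\text{ - }\mathsf{Systems}'$ and $k\text{ - }\mathsf{Systems}'*\mathbf S$ are equivalent. Moreover, if (iv) is replaced by (iv') every directed path from $\mathrm{out}\,S_i$ to $\mathrm{in}\,S_i$ has length at least $3$, then $k\text{ - }\mathsf{Systems}'$ and $k\text{ - }\mathsf{Systems}'\mathbin{\vec *}\mathbf S$ are equivalent categories.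
   Context: A digraph is a finite vertex set with a binary relation (arcs; loops and antiparallel arcs allowed, no multiple parallel arcs); homomorphisms send arcs to arcs. A binary $[k]$-system $D$ is a finite vertex set $V(D)$ with relations $A_1(D),\dots,A_k(D)\subseteq V(D)^2$ ("$i$-arcs"); homomorphisms send $i$-arcs to $i$-arcs for each $i$. The indegree (outdegree) of a vertex is the total number of incoming (outgoing) arcs over all relations. An oriented path/cycle is a path/cycle in the underlying undirected graph (arcs may be traversed in either direction); a directed path follows arc directions; a bidirected path is a path each consecutive pair of which is joined by arcs in both directions. A digraph is connected if its underlying graph is connected. Indicators $S_1,\dots,S_k$ are mutually rigid if each has only the identity endomorphism and there is no homomorphism $S_i\to S_j$ for $i\neq j$. An indicator is a digraph $S$ with a distinguished pair of distinct vertices $(\mathrm{in}\,S,\mathrm{out}\,S)$. For a binary $[k]$-system $D$ and indicators $\mathbf S=(S_1,\dots,S_k)$, take for each $i\in[k]$ and each $a\in A_i(D)$ a disjoint copy $S_{i,a}$ of $S_i$. The šíp product $D*\mathbf S$ is the digraph with vertex set $V(D)\cup\bigcup_{i,a}V(S_{i,a})$ and arcs: all arcs of all copies $S_{i,a}$, and for each $i$ and $(x,y)\in A_i(D)$ the arcs $(x,\mathrm{in}\,S_{i,(x,y)}),(\mathrm{in}\,S_{i,(x,y)},x),(\mathrm{out}\,S_{i,(x,y)},y),(y,\mathrm{out}\,S_{i,(x,y)})$. The product $D\mathbin{\vec *}\mathbf S$ has the same vertex set and arcs: all arcs of all copies, and for each $i$ and $(x,y)\in A_i(D)$ the arcs $(x,\mathrm{in}\,S_{i,(x,y)})$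 and $(\mathrm{out}\,S_{i,(x,y)},y)$. $k\text{ - }\mathsf{Systems}'$ is the category whose objects are the binary $[k]$-systems in which every vertex has indegree and outdegree at least $1$, and whose morphisms are all homomorphisms between them. $k\text{ - }\mathsf{Systems}'*\mathbf S$ (resp. $k\text{ - }\mathsf{Systems}'\mathbin{\vec *}\mathbf S$) is the category whose objects are the digraphs $D*\mathbf S$ (resp. $D\mathbin{\vec*}\mathbf S$) for $D$ an object of $k\text{ - }\mathsf{Systems}'$, with all digraph homomorphisms between them. Two categories $A,B$ are equivalent if there is a full and faithful functor $F:A\to B$ such that every object of $B$ is isomorphic to $F(a)$ for some object $a$ of $A$. -}

module Defs where

open import Data.Nat using (ℕ; zero; suc; _*_; _≤_)
open import Data.Fin using (Fin; zero; suc; fromℕ; inject₁)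
open import Data.Bool using (Bool; true; false)
open import Data.Product using (Σ; ∃; ∃₂; _×_; _,_; proj₁)
open import Data.Sum using (_⊎_)
open import Relation.Binary.PropositionalEquality using (_≡_; _≢_)
open import Relation.Nullary using (¬_)
open import Relation.Binary.Construct.Closure.ReflexiveTransitive using (Star)
open import Function.Definitions using (Injective)

record Digraph : Set₁ where
  field
    V : Set
    E : V → V → Set
open Digraph public

DHom : Digraph → Digraph → Set
DHom G H = Σ (V G → V H) λ f → ∀ {x y} → E G x y → E H (f x) (f y)

_≈D_ : ∀ {G H} → DHom G H → DHom G H → Set
_≈D_ {G} f g = ∀ (x : V G) → proj₁ f x ≡ proj₁ g x

idD : (G : Digraph) → DHom G G
idD G = (λ x → x) , (λ e → e)

_∘D_ : ∀ {G H K} → DHom H K → DHom G H → DHom G K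
_∘D_ {G} {H} {K} (g , gp) (f , fp) = (λ x → g (f x)) , (λ {x} {y} e → gp {f x} {f y} (fp {x} {y} e))

Iso : Digraph → Digraph → Set
Iso G H = Σ (DHom G H) λ f → Σ (DHom H G) λ g →
            (_≈D_ {G} {G} (_∘D_ {G} {H} {G} g f) (idD G)) ×
            (_≈D_ {H} {H} (_∘D_ {H} {G} {H} f g) (idD H))

Adj : (G : Digraph) → V G → V G → Set
Adj G x y = E G x y ⊎ E G y x

BiAdj : (G : Digraph) → V G → V G → Set
BiAdj G x y = E G x y × E G y x

Connected : Digraph → Set
Connected G = ∀ (x y : V G) → Star (Adj G) x y

Path : (G : Digraph) → (V G → V G → Set) → V G → V G → ℕ → Set
Path G R a b m =
  Σ (Fin (suc m) → V G) λ v →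
    Injective _≡_ _≡_ v × v zero ≡ a × v (fromℕ m) ≡ b ×
    (∀ (j : Fin m) → R (v (inject₁ j)) (v (suc j)))

OrPath BiPath DirPath : (G : Digraph) → V G → V G → ℕ → Set
OrPath G = Path G (Adj G)
BiPath G = Path G (BiAdj G)
DirPath G = Path G (E G)

-- an oriented cycle of length (suc p): distinct vertices v 0 .. v p,
-- consecutive ones adjacent in the underlying graph, and v p adjacent to v 0
OrCycle : (G : Digraph) → ℕ → Set
OrCycle G p =
  Σ (Fin (suc p) → V G) λ v →
    Injective _≡_ _≡_ v ×
    (∀ (j : Fin p) → Adj G (v (inject₁ j)) (v (suc j))) ×
    Adj G (v (fromℕ p)) (v zero)

HasOrCycle : Digraph → ℕ → Set
HasOrCycle G m = Σ ℕ λ p → (m ≡ suc p) × OrCycle G p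

OnOrCycle : (G : Digraph) → V G → ℕ → Set
OnOrCycle G x m = Σ ℕ λ p → (m ≡ suc p) ×
  Σ (OrCycle G p) λ c → ∃ λ (j : Fin (suc p)) → proj₁ c j ≡ x

Odd : ℕ → Set
Odd m = ∃ λ j → m ≡ suc (2 * j)

record Indicator : Set where
  field
    size  : ℕ
    arc   : Fin size → Fin size → Bool
    inS   : Fin size
    outS  : Fin size
    in≢out : inS ≢ outS
open Indicator public

IG : Indicator → Digraph
IG S = record { V = Fin (size S) ; E = λ u v → arc S u v ≡ true }

MutuallyRigid : ∀ {k} → (Fin k → Indicator) → Set
MutuallyRigid {k} S =
  (∀ i (h : DHom (IG (S i)) (IG (S i))) → _≈D_ {IG (S i)} {IG (S i)} h (idD (IG (S i)))) ×
  (∀ (i j : Fin k) → i ≢ j → ¬ DHom (IG (S i)) (IG (S j)))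

record System (k : ℕ) : Set where
  field
    nV : ℕ
    A  : Fin k → Fin nV → Fin nV → Bool
open System public

MinDeg1 : ∀ {k} → System k → Set
MinDeg1 {k} D =
  (∀ x → ∃₂ λ (i : Fin k) y → A D i x y ≡ true) ×
  (∀ x → ∃₂ λ (i : Fin k) y → A D i y x ≡ true)

Sys' : ℕ → Set
Sys' k = Σ (System k) MinDeg1

SHom : ∀ {k} → Sys' k → Sys' k → Set
SHom {k} (D , _) (D' , _) =
  Σ (Fin (nV D) → Fin (nV D')) λ f →
    ∀ (i : Fin k) x y → A D i x y ≡ true → A D' i (f x) (f y) ≡ true

_≈S_ : ∀ {k} {D D' : Sys' k} → SHom D D' → SHom D D' → Set
_≈S_ {k} {D , _} f g = ∀ (x : Fin (nV D)) → proj₁ f x ≡ proj₁ g x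

idS : ∀ {k} (D : Sys' k) → SHom D D
idS {k} (D , _) = (λ x → x) , (λ i x y p → p)

_∘S_ : ∀ {k} {D D' D'' : Sys' k} → SHom D' D'' → SHom D D' → SHom D D''
_∘S_ {k} {D , _} {D' , _} {D'' , _} (g , gp) (f , fp) =
  (λ x → g (f x)) , (λ i x y p → gp i (f x) (f y) (fp i x y p))

module _ {k : ℕ} (D : System k) (S : Fin k → Indicator) where

  -- V(D) together with, for each i and each i-arc a = (x,y), a copy of S_i
  data ProdV : Set where
    base : Fin (nV D) → ProdV
    copy : (i : Fin k) (x y : Fin (nV D)) → A D i x y ≡ true →
           Fin (size (S i)) → ProdV

  data SipE : ProdV → ProdV → Set where
    inner  : ∀ i x y p u v → arc (S i) u v ≡ true →
             SipE (copy i x y p u) (copy i x y p v)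
    x→in   : ∀ i x y p → SipE (base x) (copy i x y p (inS (S i)))
    in→x   : ∀ i x y p → SipE (copy i x y p (inS (S i))) (base x)
    out→y  : ∀ i x y p → SipE (copy i x y p (outS (S i))) (base y)
    y→out  : ∀ i x y p → SipE (base y) (copy i x y p (outS (S i)))

  data VecE : ProdV → ProdV → Set where
    inner  : ∀ i x y p u v → arc (S i) u v ≡ true →
             VecE (copy i x y p u) (copy i x y p v)
    x→in   : ∀ i x y p → VecE (base x) (copy i x y p (inS (S i)))
    out→y  : ∀ i x y p → VecE (copy i x y p (outS (S i))) (base y)

  sipProd : Digraph
  sipProd = record { V = ProdV ; E = SipE }

  vecProd : Digraph
  vecProd = record { V = ProdV ; E = VecE }

-- Equivalence of k-Systems' with a category whose objects are P D
-- (D an object of k-Systems') and whose morphisms are all digraph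
-- homomorphisms P D → P D'.

record Equivalent {k : ℕ} (P : Sys' k → Digraph) : Set₁ where
  field
    F₀      : Sys' k → Sys' k
    F₁      : ∀ {D D'} → SHom D D' → DHom (P (F₀ D)) (P (F₀ D'))
    F-resp  : ∀ {D D'} {f g : SHom D D'} → _≈S_ {k} {D} {D'} f g →
              _≈D_ {P (F₀ D)} {P (F₀ D')} (F₁ {D} {D'} f) (F₁ {D} {D'} g)
    F-id    : ∀ D → _≈D_ {P (F₀ D)} {P (F₀ D)} (F₁ {D} {D} (idS D)) (idD (P (F₀ D)))
    F-comp  : ∀ {D D' D''} (f : SHom D D') (g : SHom D' D'') →
              _≈D_ {P (F₀ D)} {P (F₀ D'')}
                (F₁ {D} {D''} (_∘S_ {k} {D} {D'} {D''} g f))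
                (_∘D_ {P (F₀ D)} {P (F₀ D')} {P (F₀ D'')} (F₁ {D'} {D''} g) (F₁ {D} {D'} f))
    full    : ∀ {D D'} (h : DHom (P (F₀ D)) (P (F₀ D'))) →
              Σ (SHom D D') λ f → _≈D_ {P (F₀ D)} {P (F₀ D')} (F₁ {D} {D'} f) h
    faithful : ∀ {D D'} (f g : SHom D D') →
              _≈D_ {P (F₀ D)} {P (F₀ D')} (F₁ {D} {D'} f) (F₁ {D} {D'} g) →
              _≈S_ {k} {D} {D'} f g
    ess-surj : ∀ (E : Sys' k) → Σ (Sys' k) λ D → Iso (P E) (P (F₀ D))

SipCat VecCat : ∀ {k} → (Fin k → Indicator) → Sys' k → Digraph
SipCat S (D , _) = sipProd D S
VecCat S (D , _) = vecProd D S

-- D ↦ D ∗ S is faithful and, being the identity on objects, essentially surjective; the point is fullness.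
-- Let h : D ∗ S → D′ ∗ S. Each vertex of a copy of S_i lies on an odd closed walk of length g, whereas an
-- odd walk between base vertices of D′ ∗ S spends an odd number of steps inside one copy between its
-- terminals and so, by (ii) and (v), is longer than g; hence h sends copy vertices to copy vertices. As
-- S_i is connected, a copy goes into a single copy, and mutual rigidity makes h the identity onto a copy
-- of S_i. A base vertex x has an out-arc and an in-arc in D, so h x is joined to an in-terminal and an
-- out-terminal; inside a copy this would give an out-in path of length at most 2, excluded by (iv)
-- resp. (iv'). So h restricts to a map of base vertices, a homomorphism D → D′ that induces h.
-- The same argument works for D →∗ S, whose arcs are among those of D ∗ S.
module Submission where

open import Defs
open import Data.Nat using (ℕ; zero; suc; _+_; _*_; _≤_; _<_; z≤n; s≤s; parity)
open import Data.Nat.Properties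
  using (≤-refl; ≤-trans; ≤-reflexive; m≤m+n; m≤n+m; m≤n⇒m≤1+n; ≤-<-trans; <-trans; ≤⇒≯; ≮⇒≥;
         +-suc; +-comm; +-identityʳ)
open import Data.Nat.Induction using (<-wellFounded)
open import Induction.WellFounded using (Acc; acc)
open import Data.Parity.Base as ℙ using (0ℙ; 1ℙ)
open import Data.Parity.Properties using (+-homo-+; *-homo-*; +-assoc)
open import Data.Fin using (Fin; zero; suc; fromℕ; inject₁)
import Data.Fin.Properties as Fin
open import Data.Bool using (true)
import Data.Bool.Properties as Bool
open import Data.Product using (Σ; ∃; ∃₂; _×_; _,_; proj₁; proj₂)
open import Data.Sum using (_⊎_; inj₁; inj₂; swap)
open import Data.Empty using (⊥; ⊥-elim)
open import Data.Unit using (⊤; tt)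
open import Function using (_∘_; id; case_of_)
open import Function.Definitions using (Injective)
open import Relation.Nullary using (¬_; Dec; yes; no)
open import Relation.Nullary.Decidable using (_⊎-dec_)
open import Relation.Binary.Core using (_=[_]⇒_)
open import Relation.Binary.Definitions using (DecidableEquality; Sym)
open import Relation.Binary.PropositionalEquality
  using (_≡_; _≢_; refl; sym; trans; cong; subst; subst₂; module ≡-Reasoning)
open import Relation.Binary.Construct.Closure.ReflexiveTransitive
  using (Star; ε; _◅_; _◅◅_; gmap; revApp; reverse)
open import Axiom.UniquenessOfIdentityProofs using (module Decidable⇒UIP)

module _ {V : Set} {R : V → V → Set} where

  length : ∀ {a b} → Star R a b → ℕ
  length ε       = 0
  length (_ ◅ w) = suc (length w)

  length-◅◅ : ∀ {a b c} (w : Star R a b) (w′ : Star R b c) →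
              length (w ◅◅ w′) ≡ length w + length w′
  length-◅◅ ε       w′ = refl
  length-◅◅ (_ ◅ w) w′ = cong suc (length-◅◅ w w′)

  length-revApp : (sym′ : Sym R R) → ∀ {a b c} (w : Star R a b) (w′ : Star R a c) →
                  length (revApp sym′ w w′) ≡ length w + length w′
  length-revApp sym′ ε       w′ = refl
  length-revApp sym′ (e ◅ w) w′ =
    trans (length-revApp sym′ w (sym′ e ◅ w′)) (+-suc (length w) (length w′))

  length-reverse : (sym′ : Sym R R) → ∀ {a b} (w : Star R a b) →
                   length (reverse sym′ w) ≡ length w
  length-reverse sym′ w = trans (length-revApp sym′ w ε) (+-identityʳ (length w))

  infix 4 _∈ᵥ_
  _∈ᵥ_ : ∀ {a b} → V → Star R a b → Set
  _∈ᵥ_ {a} x ε       = x ≡ a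
  _∈ᵥ_ {a} x (_ ◅ w) = x ≡ a ⊎ x ∈ᵥ w

  end-∈ᵥ : ∀ {a b} (w : Star R a b) → b ∈ᵥ w
  end-∈ᵥ ε       = refl
  end-∈ᵥ (_ ◅ w) = inj₂ (end-∈ᵥ w)

  ∈ᵥ-◅◅ˡ : ∀ {a b c x} (w : Star R a b) (w′ : Star R b c) → x ∈ᵥ w → x ∈ᵥ w ◅◅ w′
  ∈ᵥ-◅◅ˡ ε       ε       x≡a        = x≡a
  ∈ᵥ-◅◅ˡ ε       (_ ◅ _) x≡a        = inj₁ x≡a
  ∈ᵥ-◅◅ˡ (_ ◅ w) w′      (inj₁ x≡a) = inj₁ x≡a
  ∈ᵥ-◅◅ˡ (_ ◅ w) w′      (inj₂ x∈w) = inj₂ (∈ᵥ-◅◅ˡ w w′ x∈w)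

  split-at : ∀ {a b x} (w : Star R a b) → x ∈ᵥ w →
             ∃₂ λ (w₁ : Star R a x) (w₂ : Star R x b) → w₁ ◅◅ w₂ ≡ w
  split-at ε       refl       = ε , ε , refl
  split-at (e ◅ w) (inj₁ refl) = ε , e ◅ w , refl
  split-at (e ◅ w) (inj₂ x∈w) with split-at w x∈w
  ... | w₁ , w₂ , refl = e ◅ w₁ , w₂ , refl

  rotate : ∀ {a x} (w : Star R a a) → x ∈ᵥ w → Σ (Star R x x) λ w′ → length w′ ≡ length w
  rotate w x∈w with split-at w x∈w
  ... | w₁ , w₂ , refl = w₂ ◅◅ w₁ , (begin
    length (w₂ ◅◅ w₁)       ≡⟨ length-◅◅ w₂ w₁ ⟩
    length w₂ + length w₁   ≡⟨ +-comm (length w₂) (length w₁) ⟩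
    length w₁ + length w₂   ≡⟨ length-◅◅ w₁ w₂ ⟨
    length (w₁ ◅◅ w₂)       ∎)
    where open ≡-Reasoning

  Simple : ∀ {a b} → Star R a b → Set
  Simple ε           = ⊤
  Simple {a} (_ ◅ w) = ¬ a ∈ᵥ w × Simple w

  Simple-◅◅⁻ : ∀ {a b c} (w : Star R a b) (w′ : Star R b c) →
               Simple (w ◅◅ w′) → Simple w × Simple w′
  Simple-◅◅⁻ ε       w′ s          = tt , s
  Simple-◅◅⁻ (_ ◅ w) w′ (a∉ , s) with Simple-◅◅⁻ w w′ s
  ... | s₁ , s₂ = (a∉ ∘ ∈ᵥ-◅◅ˡ w w′ , s₁) , s₂

  vertex : ∀ {a b} (w : Star R a b) → Fin (suc (length w)) → V
  vertex {a} w       zero    = a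
  vertex     (_ ◅ w) (suc t) = vertex w t

  vertex-last : ∀ {a b} (w : Star R a b) → vertex w (fromℕ (length w)) ≡ b
  vertex-last ε       = refl
  vertex-last (_ ◅ w) = vertex-last w

  vertex-step : ∀ {a b} (w : Star R a b) (t : Fin (length w)) →
                R (vertex w (inject₁ t)) (vertex w (suc t))
  vertex-step (e ◅ w) zero    = e
  vertex-step (e ◅ w) (suc t) = vertex-step w t

  vertex-∈ᵥ : ∀ {a b} (w : Star R a b) t → vertex w t ∈ᵥ w
  vertex-∈ᵥ ε       zero    = refl
  vertex-∈ᵥ (_ ◅ w) zero    = inj₁ refl
  vertex-∈ᵥ (_ ◅ w) (suc t) = inj₂ (vertex-∈ᵥ w t)

  vertex-injective : ∀ {a b} (w : Star R a b) → Simple w → Injective _≡_ _≡_ (vertex w)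
  vertex-injective w       _        {zero}  {zero}  _  = refl
  vertex-injective (_ ◅ w) (a∉ , _) {zero}  {suc t} eq = ⊥-elim (a∉ (subst (_∈ᵥ w) (sym eq) (vertex-∈ᵥ w t)))
  vertex-injective (_ ◅ w) (a∉ , _) {suc s} {zero}  eq = ⊥-elim (a∉ (subst (_∈ᵥ w) eq (vertex-∈ᵥ w s)))
  vertex-injective (_ ◅ w) (_ , sw) {suc s} {suc t} eq = cong suc (vertex-injective w sw eq)

  walk-along : ∀ p (v : Fin (suc p) → V) → (∀ t → R (v (inject₁ t)) (v (suc t))) →
               Star R (v zero) (v (fromℕ p))
  walk-along zero    v step = ε
  walk-along (suc p) v step = step zero ◅ walk-along p (v ∘ suc) (step ∘ suc)

  length-walk-along : ∀ p v step → length (walk-along p v step) ≡ p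
  length-walk-along zero    v step = refl
  length-walk-along (suc p) v step = cong suc (length-walk-along p (v ∘ suc) (step ∘ suc))

  ∈ᵥ-walk-along : ∀ p v step t → v t ∈ᵥ walk-along p v step
  ∈ᵥ-walk-along zero    v step zero    = refl
  ∈ᵥ-walk-along (suc p) v step zero    = inj₁ refl
  ∈ᵥ-walk-along (suc p) v step (suc t) = inj₂ (∈ᵥ-walk-along p (v ∘ suc) (step ∘ suc) t)

  module _ (_≟_ : DecidableEquality V) where

    _∈ᵥ?_ : ∀ {a b} x (w : Star R a b) → Dec (x ∈ᵥ w)
    _∈ᵥ?_ {a} x ε       = x ≟ a
    _∈ᵥ?_ {a} x (_ ◅ w) = x ≟ a ⊎-dec x ∈ᵥ? w

length-gmap : ∀ {V W : Set} {R : V → V → Set} {Q : W → W → Set}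
              (f : V → W) (g : R =[ f ]⇒ Q) {a b} (w : Star R a b) →
              length (gmap {U = Q} f g w) ≡ length w
length-gmap f g ε       = refl
length-gmap f g (_ ◅ w) = cong suc (length-gmap f g w)

Odd⇒parity≡1ℙ : ∀ {m} → Odd m → parity m ≡ 1ℙ
Odd⇒parity≡1ℙ (j , refl) = trans (+-homo-+ 1 (2 * j)) (cong (1ℙ ℙ.+_) (*-homo-* 2 j))

parity≡1ℙ⇒Odd : ∀ m → parity m ≡ 1ℙ → Odd m
parity≡1ℙ⇒Odd 0             ()
parity≡1ℙ⇒Odd 1             _   = 0 , refl
parity≡1ℙ⇒Odd (suc (suc m)) odd with parity≡1ℙ⇒Odd m odd
... | j , refl = suc j , cong (2 +_) (sym (+-suc j (j + 0)))

parity-+≡1ℙ : ∀ m n → parity (m + n) ≡ 1ℙ → parity m ≡ 1ℙ ⊎ parity n ≡ 1ℙ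
parity-+≡1ℙ m n odd = summand (parity m) (parity n) (trans (sym (+-homo-+ m n)) odd)
  where
  summand : ∀ p q → p ℙ.+ q ≡ 1ℙ → p ≡ 1ℙ ⊎ q ≡ 1ℙ
  summand 1ℙ _ _   = inj₁ refl
  summand 0ℙ _ q≡1 = inj₂ q≡1

parity-suc-cong : ∀ m n → parity m ≡ parity n → parity (suc m) ≡ parity (suc n)
parity-suc-cong m n eq = trans (+-homo-+ 1 m) (trans (cong (1ℙ ℙ.+_) eq) (sym (+-homo-+ 1 n)))

toPath : (G : Digraph) {R : V G → V G → Set} {a b : V G} (w : Star R a b) →
         Simple w → Path G R a b (length w)
toPath G w simple = vertex w , vertex-injective w simple , refl , vertex-last w , vertex-step w

path-of-length≤2 : (G : Digraph) → DecidableEquality (V G) → {R : V G → V G → Set} {a b c : V G} →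
                   a ≢ c → R a b → R b c → ∃ λ m → m ≤ 2 × Path G R a c m
path-of-length≤2 G _≟_ {a = a} {b} {c} a≢c r₁ r₂ with b ≟ a | b ≟ c
... | yes refl | _        = 1 , s≤s z≤n , toPath G (r₂ ◅ ε) (a≢c , tt)
... | no _     | yes refl = 1 , s≤s z≤n , toPath G (r₁ ◅ ε) (a≢c , tt)
... | no b≢a   | no b≢c   = 2 , ≤-refl , toPath G (r₁ ◅ r₂ ◅ ε) (a∉ , b≢c , tt)
  where
  a∉ : ¬ (a ≡ b ⊎ a ≡ c)
  a∉ (inj₁ a≡b) = b≢a (sym a≡b)
  a∉ (inj₂ a≡c) = a≢c a≡c

closed-walk-through : ∀ {G : Digraph} {x m} → OnOrCycle G x m →
                      Σ (Star (Adj G) x x) λ w → length w ≡ m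
closed-walk-through (p , refl , (v , _ , step , close) , t , refl)
  with rotate (close ◅ walk-along p v step) (inj₂ (∈ᵥ-walk-along p v step t))
... | w , |w| = w , trans |w| (cong suc (length-walk-along p v step))

module OddCycles (G : Digraph) (_≟_ : DecidableEquality (V G)) where

  OddCycleWithin : ℕ → Set
  OddCycleWithin L = ∃ λ m → m ≤ L × Odd m × HasOrCycle G m

  closing-cycle : ∀ {a c} (w : Star (Adj G) c a) → Simple w → Adj G a c → OrCycle G (length w)
  closing-cycle {c = c} w simple e =
    vertex w , vertex-injective w simple , vertex-step w , subst (λ v → Adj G v c) (sym (vertex-last w)) e

  Shortcut : V G → V G → ℕ → Set
  Shortcut a b n = OddCycleWithin n ⊎
    Σ (Star (Adj G) a b) λ w → Simple w × length w ≤ n × parity (length w) ≡ parity n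

  -- e and the walk w₁ back to its tail form a cycle; if that cycle is even, dropping it keeps the parity.
  close-or-drop : ∀ {a c b n} (e : Adj G a c) (w₁ : Star (Adj G) c a) (w₂ : Star (Adj G) a b) →
                  Simple w₁ × Simple w₂ → length w₁ + length w₂ ≤ n →
                  parity (length w₁ + length w₂) ≡ parity n → Shortcut a b (suc n)
  close-or-drop {n = n} e w₁ w₂ (s₁ , s₂) w₁₂≤n same with parity (length w₁) in p₁
  ... | 0ℙ = inj₁ (suc (length w₁) , s≤s (≤-trans (m≤m+n _ _) w₁₂≤n) ,
                   parity≡1ℙ⇒Odd _ (trans (+-homo-+ 1 (length w₁)) (cong (1ℙ ℙ.+_) p₁)) ,
                   length w₁ , refl , closing-cycle w₁ s₁ e)
  ... | 1ℙ = inj₂ (w₂ , s₂ , m≤n⇒m≤1+n (≤-trans (m≤n+m _ _) w₁₂≤n) , (begin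
    parity (length w₂)                                 ≡⟨ +-assoc 1ℙ 1ℙ (parity (length w₂)) ⟩
    1ℙ ℙ.+ (1ℙ ℙ.+ parity (length w₂))                 ≡⟨ cong (λ p → 1ℙ ℙ.+ (p ℙ.+ parity (length w₂))) p₁ ⟨
    1ℙ ℙ.+ (parity (length w₁) ℙ.+ parity (length w₂)) ≡⟨ cong (1ℙ ℙ.+_) (+-homo-+ (length w₁) (length w₂)) ⟨
    1ℙ ℙ.+ parity (length w₁ + length w₂)              ≡⟨ cong (1ℙ ℙ.+_) same ⟩
    1ℙ ℙ.+ parity n                                    ≡⟨ +-homo-+ 1 n ⟨
    parity (suc n)                                     ∎))
    where open ≡-Reasoning

  shortcut : ∀ {a b} (w : Star (Adj G) a b) → Shortcut a b (length w)
  shortcut ε = inj₂ (ε , tt , z≤n , refl)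
  shortcut {a} (e ◅ w) with shortcut w
  ... | inj₁ (m , m≤ , odd , cycle) = inj₁ (m , m≤n⇒m≤1+n m≤ , odd , cycle)
  ... | inj₂ (w′ , simple , w′≤w , same) with _∈ᵥ?_ _≟_ a w′
  ...   | no a∉w′ =
    inj₂ (e ◅ w′ , (a∉w′ , simple) , s≤s w′≤w , parity-suc-cong (length w′) (length w) same)
  ...   | yes a∈w′ with split-at w′ a∈w′
  ...     | w₁ , w₂ , refl =
    close-or-drop e w₁ w₂ (Simple-◅◅⁻ w₁ w₂ simple)
                  (subst (_≤ length w) |w₁◅◅w₂| w′≤w) (trans (cong parity (sym |w₁◅◅w₂|)) same)
    where
    |w₁◅◅w₂| : length (w₁ ◅◅ w₂) ≡ length w₁ + length w₂
    |w₁◅◅w₂| = length-◅◅ w₁ w₂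

  odd-closed-walk⇒odd-cycle : ∀ {a} (w : Star (Adj G) a a) → parity (length w) ≡ 1ℙ →
                              OddCycleWithin (length w)
  odd-closed-walk⇒odd-cycle w odd with shortcut w
  ... | inj₁ cycle                          = cycle
  ... | inj₂ (ε , _ , _ , even≡odd)         = case trans even≡odd odd of λ ()
  ... | inj₂ (_ ◅ w′ , (a∉w′ , _) , _ , _)  = ⊥-elim (a∉w′ (end-∈ᵥ w′))

  odd-walk⇒odd-cycle⊎odd-path : ∀ {a b} (w : Star (Adj G) a b) → parity (length w) ≡ 1ℙ →
    OddCycleWithin (length w) ⊎ ∃ λ m → m ≤ length w × Odd m × OrPath G a b m
  odd-walk⇒odd-cycle⊎odd-path w odd with shortcut w
  ... | inj₁ cycle                   = inj₁ cycle
  ... | inj₂ (w′ , simple , w′≤w , same) =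
    inj₂ (length w′ , w′≤w , parity≡1ℙ⇒Odd _ (trans same odd) , toPath G w′ simple)

Terminal : (S : Indicator) → Fin (size S) → Set
Terminal S t = t ≡ inS S ⊎ t ≡ outS S

OddTerminalWalksLong : Indicator → ℕ → Set
OddTerminalWalksLong S g = ∀ {t t′} → Terminal S t → Terminal S t′ → (w : Star (Adj (IG S)) t t′) →
                           parity (length w) ≡ 1ℙ → g ≤ length w

module _ (S : Indicator) {g : ℕ}
  (odd-girth : ∀ m → Odd m → m < g → ¬ HasOrCycle (IG S) m)
  (odd-paths : ∀ m → OrPath (IG S) (outS S) (inS S) m → Odd m → g ≤ m) where

  open OddCycles (IG S) Fin._≟_

  g≤odd-cycle : ∀ {L} → OddCycleWithin L → g ≤ L
  g≤odd-cycle (m , m≤L , odd , cycle) = ≤-trans (≮⇒≥ λ m<g → odd-girth m odd m<g cycle) m≤L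

  g≤odd-out-in-walk : (w : Star (Adj (IG S)) (outS S) (inS S)) → parity (length w) ≡ 1ℙ → g ≤ length w
  g≤odd-out-in-walk w odd with odd-walk⇒odd-cycle⊎odd-path w odd
  ... | inj₁ cycle                = g≤odd-cycle cycle
  ... | inj₂ (m , m≤ , odd-m , path) = ≤-trans (odd-paths m path odd-m) m≤

  g≤odd-terminal-walk : OddTerminalWalksLong S g
  g≤odd-terminal-walk (inj₁ refl) (inj₁ refl) w odd = g≤odd-cycle (odd-closed-walk⇒odd-cycle w odd)
  g≤odd-terminal-walk (inj₂ refl) (inj₂ refl) w odd = g≤odd-cycle (odd-closed-walk⇒odd-cycle w odd)
  g≤odd-terminal-walk (inj₂ refl) (inj₁ refl) w odd = g≤odd-out-in-walk w odd
  g≤odd-terminal-walk (inj₁ refl) (inj₂ refl) w odd =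
    subst (g ≤_) |w̃|≡|w| (g≤odd-out-in-walk w̃ (trans (cong parity |w̃|≡|w|) odd))
    where
    w̃ : Star (Adj (IG S)) (outS S) (inS S)
    w̃ = reverse swap w
    |w̃|≡|w| : length w̃ ≡ length w
    |w̃|≡|w| = length-reverse swap w

module _ {k : ℕ} (S : Fin k → Indicator) where

  base-copy-arc : ∀ {D : System k} {z i x y p u} → SipE D S (base z) (copy i x y p u) →
                  (u ≡ inS (S i) × z ≡ x) ⊎ (u ≡ outS (S i) × z ≡ y)
  base-copy-arc (x→in _ _ _ _)  = inj₁ (refl , refl)
  base-copy-arc (y→out _ _ _ _) = inj₂ (refl , refl)

  copy-base-arc : ∀ {D : System k} {z i x y p u} → SipE D S (copy i x y p u) (base z) →
                  (u ≡ inS (S i) × z ≡ x) ⊎ (u ≡ outS (S i) × z ≡ y)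
  copy-base-arc (in→x _ _ _ _)  = inj₁ (refl , refl)
  copy-base-arc (out→y _ _ _ _) = inj₂ (refl , refl)

  copy-copy-arc : ∀ {D : System k} {i x y p u v} → SipE D S (copy i x y p u) (copy i x y p v) →
                  arc (S i) u v ≡ true
  copy-copy-arc (inner _ _ _ _ _ _ a) = a

  record Copy (D : System k) : Set where
    constructor ⟨_,_,_,_⟩
    field
      index      : Fin k
      tail head  : Fin (nV D)
      index-arc  : A D index tail head ≡ true

  InCopy : ∀ {D} → Copy D → ProdV D S → Set
  InCopy ⟨ i , x , y , p ⟩ s = ∃ λ u → s ≡ copy i x y p u

  copy-neighbour : ∀ {D} (c : Copy D) {s s′} → Adj (sipProd D S) s s′ → InCopy c s →
                   InCopy c s′ ⊎ ∃ λ z → s′ ≡ base z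
  copy-neighbour c (inj₁ (inner _ _ _ _ _ v _)) (_ , refl) = inj₁ (v , refl)
  copy-neighbour c (inj₂ (inner _ _ _ _ v _ _)) (_ , refl) = inj₁ (v , refl)
  copy-neighbour c (inj₁ (in→x _ x _ _))        (_ , refl) = inj₂ (x , refl)
  copy-neighbour c (inj₁ (out→y _ _ y _))       (_ , refl) = inj₂ (y , refl)
  copy-neighbour c (inj₂ (x→in _ x _ _))        (_ , refl) = inj₂ (x , refl)
  copy-neighbour c (inj₂ (y→out _ _ y _))       (_ , refl) = inj₂ (y , refl)

module OddProductWalks {k : ℕ} (S : Fin k → Indicator) {g : ℕ}
  (g≤odd-terminal-walk : ∀ i → OddTerminalWalksLong (S i) g)
  (D : System k) where

  private
    Walk : ProdV D S → ProdV D S → Set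
    Walk = Star (Adj (sipProd D S))

  record Exit (i : Fin k) (u : Fin (size (S i))) (z : Fin (nV D)) (n : ℕ) : Set where
    constructor exit
    field
      {t}      : Fin (size (S i))
      {z′}     : Fin (nV D)
      terminal : Terminal (S i) t
      inside   : Star (Adj (IG (S i))) u t
      rest     : Walk (base z′) (base z)
      length≡  : n ≡ suc (length inside + length rest)

  exit-◅ : ∀ {i u v z n} → Adj (IG (S i)) u v → Exit i v z n → Exit i u z (suc n)
  exit-◅ e (exit t q w′ eq) = exit t (e ◅ q) w′ (cong suc eq)

  leave-copy : ∀ {i x y p u z} (w : Walk (copy i x y p u) (base z)) → Exit i u z (length w)
  leave-copy (inj₁ (inner _ _ _ _ _ _ a) ◅ w) = exit-◅ (inj₁ a) (leave-copy w)
  leave-copy (inj₂ (inner _ _ _ _ _ _ a) ◅ w) = exit-◅ (inj₂ a) (leave-copy w)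
  leave-copy (inj₁ (in→x _ _ _ _) ◅ w)       = exit (inj₁ refl) ε w refl
  leave-copy (inj₁ (out→y _ _ _ _) ◅ w)      = exit (inj₂ refl) ε w refl
  leave-copy (inj₂ (x→in _ _ _ _) ◅ w)       = exit (inj₁ refl) ε w refl
  leave-copy (inj₂ (y→out _ _ _ _) ◅ w)      = exit (inj₂ refl) ε w refl

  -- Split off the first excursion into a copy: either its part inside the copy is odd, and then
  -- at least g long, or the remaining walk between base vertices is odd and shorter.
  mutual
    g<odd-base-walk′ : ∀ {x z} (w : Walk (base x) (base z)) → Acc _<_ (length w) →
                       parity (length w) ≡ 1ℙ → g < length w
    g<odd-base-walk′ (inj₁ (x→in _ _ _ _) ◅ w)  = g<odd-excursion (inj₁ refl) w
    g<odd-base-walk′ (inj₁ (y→out _ _ _ _) ◅ w) = g<odd-excursion (inj₂ refl) w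
    g<odd-base-walk′ (inj₂ (in→x _ _ _ _) ◅ w)  = g<odd-excursion (inj₁ refl) w
    g<odd-base-walk′ (inj₂ (out→y _ _ _ _) ◅ w) = g<odd-excursion (inj₂ refl) w

    g<odd-excursion : ∀ {i x y p s z} → Terminal (S i) s → (w : Walk (copy i x y p s) (base z)) →
                      Acc _<_ (suc (length w)) → parity (suc (length w)) ≡ 1ℙ → g < suc (length w)
    g<odd-excursion {i} entry w (acc rs) odd with leave-copy w
    ... | exit departure q w′ |w|≡
        with parity-+≡1ℙ (length q) (length w′) (subst (λ n → parity (suc n) ≡ 1ℙ) |w|≡ odd)
    ... | inj₁ odd-q  = ≤-<-trans (g≤odd-terminal-walk i entry departure q odd-q) q<
      where
      q< : length q < suc (length w)
      q< = s≤s (≤-trans (m≤n⇒m≤1+n (m≤m+n _ _)) (≤-reflexive (sym |w|≡)))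
    ... | inj₂ odd-w′ = <-trans (g<odd-base-walk′ w′ (rs w′<) odd-w′) w′<
      where
      w′< : length w′ < suc (length w)
      w′< = s≤s (≤-trans (m≤n⇒m≤1+n (m≤n+m _ _)) (≤-reflexive (sym |w|≡)))

  g<odd-base-walk : ∀ {x z} (w : Walk (base x) (base z)) → parity (length w) ≡ 1ℙ → g < length w
  g<odd-base-walk w = g<odd-base-walk′ w (<-wellFounded (length w))

  short-odd-closed-walk-avoids-base : ∀ {s} (w : Walk s s) → parity (length w) ≡ 1ℙ → length w ≤ g →
                                      ∀ {z} → s ≢ base z
  short-odd-closed-walk-avoids-base w odd |w|≤g refl = ≤⇒≯ |w|≤g (g<odd-base-walk w odd)

IsSystemHom : ∀ {k} (D D′ : System k) → (Fin (nV D) → Fin (nV D′)) → Set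
IsSystemHom {k} D D′ f = ∀ (i : Fin k) x y → A D i x y ≡ true → A D′ i (f x) (f y) ≡ true

arc-image : ∀ {G H : Digraph} (h : DHom G H) {a b a′ b′} →
            proj₁ h a ≡ a′ → proj₁ h b ≡ b′ → E G a b → E H a′ b′
arc-image {H = H} h a↦a′ b↦b′ e = subst₂ (E H) a↦a′ b↦b′ (proj₂ h e)

module _ {k : ℕ} (S : Fin k → Indicator) where

  prodMap : ∀ {D D′ : System k} (f : Fin (nV D) → Fin (nV D′)) → IsSystemHom D D′ f →
            ProdV D S → ProdV D′ S
  prodMap f f-hom (base x)         = base (f x)
  prodMap f f-hom (copy i x y p u) = copy i (f x) (f y) (f-hom i x y p) u

  copy-cong : ∀ {D : System k} {i x x′ y y′ u} {p : A D i x y ≡ true} {p′ : A D i x′ y′ ≡ true} →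
              x ≡ x′ → y ≡ y′ → copy {D = D} {S = S} i x y p u ≡ copy i x′ y′ p′ u
  copy-cong {p = p} {p′} refl refl = cong (λ q → copy _ _ _ q _) (Decidable⇒UIP.≡-irrelevant Bool._≟_ p p′)

  base-injective : ∀ {D : System k} {x y} → base {D = D} {S = S} x ≡ base y → x ≡ y
  base-injective refl = refl

  -- Common interface to the arcs of D ∗ S and D →∗ S; ⊆sip lets walks in either be read in D ∗ S.
  record ProductArcs : Set₁ where
    field
      Arc       : (D : System k) → ProdV D S → ProdV D S → Set
      inner-arc : ∀ {D} i x y p {u v} → arc (S i) u v ≡ true → Arc D (copy i x y p u) (copy i x y p v)
      x→in-arc  : ∀ {D} i x y p → Arc D (base x) (copy i x y p (inS (S i)))
      out→y-arc : ∀ {D} i x y p → Arc D (copy i x y p (outS (S i))) (base y)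
      ⊆sip      : ∀ {D a b} → Arc D a b → SipE D S a b
      map       : ∀ {D D′} (f : Fin (nV D) → Fin (nV D′)) (f-hom : IsSystemHom D D′ f) →
                  ∀ {a b} → Arc D a b → Arc D′ (prodMap f f-hom a) (prodMap f f-hom b)

    product : System k → Digraph
    product D = record { V = ProdV D S ; E = Arc D }

    BaseNotSentIntoCopy : Set
    BaseNotSentIntoCopy =
      ∀ {D D′} (h : DHom (product D) (product D′)) {i x y p i′ z q x₁ y₁ p₁ z₂ x₂ q₂ j a b r w} →
      proj₁ h (copy i x y p (inS (S i))) ≡ copy i x₁ y₁ p₁ (inS (S i)) →
      proj₁ h (copy i′ z x q (outS (S i′))) ≡ copy i′ z₂ x₂ q₂ (outS (S i′)) →
      proj₁ h (base x) ≢ copy j a b r w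

module Fullness {k : ℕ} {S : Fin k → Indicator} (P : ProductArcs S) {g : ℕ}
  (connected : ∀ i → Connected (IG (S i)))
  (rigid : MutuallyRigid S)
  (g-odd : Odd g)
  (on-g-cycle : ∀ i v → OnOrCycle (IG (S i)) v g)
  (g≤odd-terminal-walk : ∀ i → OddTerminalWalksLong (S i) g)
  (base-not-sent-into-copy : ProductArcs.BaseNotSentIntoCopy P)
  where

  open ProductArcs P

  module _ {D D′ : System k} (h : DHom (product D) (product D′)) where

    private
      h₀ : ProdV D S → ProdV D′ S
      h₀ = proj₁ h

    h-sip-arc : ∀ {s t s′ t′} → h₀ s ≡ s′ → h₀ t ≡ t′ → Arc D s t → SipE D′ S s′ t′
    h-sip-arc s↦s′ t↦t′ = ⊆sip ∘ arc-image {product D} {product D′} h s↦s′ t↦t′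

    copy-adj-image : ∀ i x y p {u v} → Adj (IG (S i)) u v →
                     Adj (sipProd D′ S) (h₀ (copy i x y p u)) (h₀ (copy i x y p v))
    copy-adj-image i x y p (inj₁ a) = inj₁ (h-sip-arc refl refl (inner-arc i x y p a))
    copy-adj-image i x y p (inj₂ a) = inj₂ (h-sip-arc refl refl (inner-arc i x y p a))

    copy-image-not-base : ∀ i x y p u {z} → h₀ (copy i x y p u) ≢ base z
    copy-image-not-base i x y p u with closed-walk-through (on-g-cycle i u)
    ... | w , |w|≡g =
      OddProductWalks.short-odd-closed-walk-avoids-base S g≤odd-terminal-walk D′ image
        (subst (λ n → parity n ≡ 1ℙ) (sym |image|≡g) (Odd⇒parity≡1ℙ g-odd)) (≤-reflexive |image|≡g)
      where
      image : Star (Adj (sipProd D′ S)) (h₀ (copy i x y p u)) (h₀ (copy i x y p u))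
      image = gmap (h₀ ∘ copy i x y p) (copy-adj-image i x y p) w
      |image|≡g : length image ≡ g
      |image|≡g = trans (length-gmap _ _ w) |w|≡g

    copy-image-in-copy : ∀ i x y p u → ∃ λ (c : Copy S D′) → InCopy S c (h₀ (copy i x y p u))
    copy-image-in-copy i x y p u with h₀ (copy i x y p u) in eq
    ... | base z            = ⊥-elim (copy-image-not-base i x y p u eq)
    ... | copy j x′ y′ p′ w = ⟨ j , x′ , y′ , p′ ⟩ , w , refl

    copy-image-within-copy : ∀ i x y p → Σ (Copy S D′) λ c → ∀ u → InCopy S c (h₀ (copy i x y p u))
    copy-image-within-copy i x y p with copy-image-in-copy i x y p (inS (S i))
    ... | c , in-c = c , λ u → spread (connected i (inS (S i)) u) in-c
      where
      spread : ∀ {u v} → Star (Adj (IG (S i))) u v →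
               InCopy S c (h₀ (copy i x y p u)) → InCopy S c (h₀ (copy i x y p v))
      spread ε       in-c = in-c
      spread (e ◅ w) in-c with copy-neighbour S c (copy-adj-image i x y p e) in-c
      ... | inj₁ in-c′    = spread w in-c′
      ... | inj₂ (z , eq) = ⊥-elim (copy-image-not-base i x y p _ eq)

    copy-hom : ∀ {i x y p} (c : Copy S D′) → (∀ u → InCopy S c (h₀ (copy i x y p u))) →
               DHom (IG (S i)) (IG (S (Copy.index c)))
    copy-hom {i} {x} {y} {p} c within = proj₁ ∘ within , λ {u} {v} a →
      copy-copy-arc S (h-sip-arc (proj₂ (within u)) (proj₂ (within v)) (inner-arc i x y p a))

    record CopyImage (i : Fin k) (x y : Fin (nV D)) (p : A D i x y ≡ true) : Set where
      field
        {tail′ head′} : Fin (nV D′)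
        arc′          : A D′ i tail′ head′ ≡ true
        image         : ∀ u → h₀ (copy i x y p u) ≡ copy i tail′ head′ arc′ u

    copy-image : ∀ i x y p → CopyImage i x y p
    copy-image i x y p with copy-image-within-copy i x y p
    ... | c@(⟨ j , x′ , y′ , p′ ⟩) , within with i Fin.≟ j
    ...   | no i≢j   = ⊥-elim (proj₂ rigid i j i≢j (copy-hom c within))
    ...   | yes refl = record
      { arc′  = p′
      ; image = λ u → trans (proj₂ (within u)) (cong (copy i x′ y′ p′) (proj₁ rigid i (copy-hom c within) u))
      }

    open CopyImage

    base-image : MinDeg1 D → ∀ x → ∃ λ x′ → h₀ (base x) ≡ base x′
    base-image (has-out , has-in) x with h₀ (base x) in eq
    ... | base x′        = x′ , refl
    ... | copy j a b r w with has-out x | has-in x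
    ...   | i , y , p | i′ , z , q =
      ⊥-elim (base-not-sent-into-copy h (image (copy-image i x y p) (inS (S i)))
                                        (image (copy-image i′ z x q) (outS (S i′))) eq)

    module _ (min-deg : MinDeg1 D) where

      base-map : Fin (nV D) → Fin (nV D′)
      base-map x = proj₁ (base-image min-deg x)

      tail-image : ∀ i x y p → base-map x ≡ tail′ (copy-image i x y p)
      tail-image i x y p
        with base-copy-arc S (h-sip-arc (proj₂ (base-image min-deg x)) (image (copy-image i x y p) (inS (S i)))
                                        (x→in-arc i x y p))
      ... | inj₁ (_ , eq)      = eq
      ... | inj₂ (in≡out , _)  = ⊥-elim (in≢out (S i) in≡out)

      head-image : ∀ i x y p → base-map y ≡ head′ (copy-image i x y p)
      head-image i x y p
        with copy-base-arc S (h-sip-arc (image (copy-image i x y p) (outS (S i))) (proj₂ (base-image min-deg y))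
                                        (out→y-arc i x y p))
      ... | inj₁ (out≡in , _) = ⊥-elim (in≢out (S i) (sym out≡in))
      ... | inj₂ (_ , eq)     = eq

      base-map-hom : IsSystemHom D D′ base-map
      base-map-hom i x y p = subst₂ (λ a b → A D′ i a b ≡ true) (sym (tail-image i x y p)) (sym (head-image i x y p))
                                    (arc′ (copy-image i x y p))

      prodMap-base-map : ∀ s → prodMap S base-map base-map-hom s ≡ h₀ s
      prodMap-base-map (base x)         = sym (proj₂ (base-image min-deg x))
      prodMap-base-map (copy i x y p u) =
        trans (copy-cong S (tail-image i x y p) (head-image i x y p)) (sym (image (copy-image i x y p) u))

  equivalence : Equivalent (λ D → product (proj₁ D))
  equivalence = record
    { F₀       = id
    ; F₁       = λ (f , f-hom) → prodMap S f f-hom , map f f-hom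
    ; F-resp   = λ { f≈g (base x) → cong base (f≈g x) ; f≈g (copy i x y p u) → copy-cong S (f≈g x) (f≈g y) }
    ; F-id     = λ { _ (base x) → refl ; _ (copy i x y p u) → refl }
    ; F-comp   = λ { _ _ (base x) → refl ; _ _ (copy i x y p u) → refl }
    ; full     = λ { {D , min-deg} h → (base-map h min-deg , base-map-hom h min-deg) , prodMap-base-map h min-deg }
    ; faithful = λ _ _ F≈ x → base-injective S (F≈ (base x))
    ; ess-surj = λ E → E , idD _ , idD _ , (λ _ → refl) , (λ _ → refl)
    }

module _ {k : ℕ} (S : Fin k → Indicator) where

  sip-arcs : ProductArcs S
  sip-arcs = record
    { Arc       = λ D → SipE D S
    ; inner-arc = λ i x y p a → inner i x y p _ _ a
    ; x→in-arc  = x→in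
    ; out→y-arc = out→y
    ; ⊆sip      = id
    ; map       = sip-map
    }
    where
    sip-map : ∀ {D D′} (f : Fin (nV D) → Fin (nV D′)) (f-hom : IsSystemHom D D′ f) {a b} →
              SipE D S a b → SipE D′ S (prodMap S f f-hom a) (prodMap S f f-hom b)
    sip-map f f-hom (inner i x y p u v a) = inner i (f x) (f y) (f-hom i x y p) u v a
    sip-map f f-hom (x→in i x y p)        = x→in i (f x) (f y) (f-hom i x y p)
    sip-map f f-hom (in→x i x y p)        = in→x i (f x) (f y) (f-hom i x y p)
    sip-map f f-hom (out→y i x y p)       = out→y i (f x) (f y) (f-hom i x y p)
    sip-map f f-hom (y→out i x y p)       = y→out i (f x) (f y) (f-hom i x y p)

  vec-arcs : ProductArcs S
  vec-arcs = record
    { Arc       = λ D → VecE D S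
    ; inner-arc = λ i x y p a → inner i x y p _ _ a
    ; x→in-arc  = x→in
    ; out→y-arc = out→y
    ; ⊆sip      = vec⊆sip
    ; map       = vec-map
    }
    where
    vec⊆sip : ∀ {D a b} → VecE D S a b → SipE D S a b
    vec⊆sip (inner i x y p u v a) = inner i x y p u v a
    vec⊆sip (x→in i x y p)        = x→in i x y p
    vec⊆sip (out→y i x y p)       = out→y i x y p

    vec-map : ∀ {D D′} (f : Fin (nV D) → Fin (nV D′)) (f-hom : IsSystemHom D D′ f) {a b} →
              VecE D S a b → VecE D′ S (prodMap S f f-hom a) (prodMap S f f-hom b)
    vec-map f f-hom (inner i x y p u v a) = inner i (f x) (f y) (f-hom i x y p) u v a
    vec-map f f-hom (x→in i x y p)        = x→in i (f x) (f y) (f-hom i x y p)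
    vec-map f f-hom (out→y i x y p)       = out→y i (f x) (f y) (f-hom i x y p)

  sip-no-copy-vertex-between-terminals :
    (∀ i m → BiPath (IG (S i)) (outS (S i)) (inS (S i)) m → 3 ≤ m) →
    ∀ {D′ : System k} {j a b r w i x₁ y₁ p₁ i′ z₂ x₂ q₂} →
    BiAdj (sipProd D′ S) (copy j a b r w) (copy i x₁ y₁ p₁ (inS (S i))) →
    BiAdj (sipProd D′ S) (copy i′ z₂ x₂ q₂ (outS (S i′))) (copy j a b r w) → ⊥
  sip-no-copy-vertex-between-terminals bi-long {i = i}
    (inner _ _ _ _ _ _ a₁ , inner _ _ _ _ _ _ a₂) (inner _ _ _ _ _ _ a₃ , inner _ _ _ _ _ _ a₄)
    with path-of-length≤2 (IG (S i)) Fin._≟_ {R = BiAdj (IG (S i))} (in≢out (S i) ∘ sym) (a₃ , a₄) (a₁ , a₂)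
  ... | m , m≤2 , path = ≤⇒≯ m≤2 (bi-long i m path)

  sip-base-not-sent-into-copy : (∀ i m → BiPath (IG (S i)) (outS (S i)) (inS (S i)) m → 3 ≤ m) →
                                ProductArcs.BaseNotSentIntoCopy sip-arcs
  sip-base-not-sent-into-copy bi-long {D} {D′} h {i} {x} {y} {p} {i′} {z} {q} in↦in out↦out x↦copy =
    sip-no-copy-vertex-between-terminals bi-long
      (h-arc x↦copy in↦in (x→in i x y p) , h-arc in↦in x↦copy (in→x i x y p))
      (h-arc out↦out x↦copy (out→y i′ z x q) , h-arc x↦copy out↦out (y→out i′ z x q))
    where
    h-arc : ∀ {s t s′ t′} → proj₁ h s ≡ s′ → proj₁ h t ≡ t′ → SipE D S s t → SipE D′ S s′ t′
    h-arc = arc-image {sipProd D S} {sipProd D′ S} h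

  vec-no-copy-vertex-between-terminals :
    (∀ i m → DirPath (IG (S i)) (outS (S i)) (inS (S i)) m → 3 ≤ m) →
    ∀ {D′ : System k} {j a b r w i x₁ y₁ p₁ i′ z₂ x₂ q₂} →
    VecE D′ S (copy j a b r w) (copy i x₁ y₁ p₁ (inS (S i))) →
    VecE D′ S (copy i′ z₂ x₂ q₂ (outS (S i′))) (copy j a b r w) → ⊥
  vec-no-copy-vertex-between-terminals di-long {i = i} (inner _ _ _ _ _ _ a₁) (inner _ _ _ _ _ _ a₃)
    with path-of-length≤2 (IG (S i)) Fin._≟_ {R = E (IG (S i))} (in≢out (S i) ∘ sym) a₃ a₁
  ... | m , m≤2 , path = ≤⇒≯ m≤2 (di-long i m path)

  vec-base-not-sent-into-copy : (∀ i m → DirPath (IG (S i)) (outS (S i)) (inS (S i)) m → 3 ≤ m) →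
                                ProductArcs.BaseNotSentIntoCopy vec-arcs
  vec-base-not-sent-into-copy di-long {D} {D′} h {i} {x} {y} {p} {i′} {z} {q} in↦in out↦out x↦copy =
    vec-no-copy-vertex-between-terminals di-long
      (h-arc x↦copy in↦in (x→in i x y p)) (h-arc out↦out x↦copy (out→y i′ z x q))
    where
    h-arc : ∀ {s t s′ t′} → proj₁ h s ≡ s′ → proj₁ h t ≡ t′ → VecE D S s t → VecE D′ S s′ t′
    h-arc = arc-image {vecProd D S} {vecProd D′ S} h

lemma4p3 : (k : ℕ) → 1 ≤ k → (S : Fin k → Indicator) →
    -- (i)
    (∀ i → Connected (IG (S i))) → MutuallyRigid S →
    -- (ii)
    (g : ℕ) → Odd g →
    (∀ i → HasOrCycle (IG (S i)) g) →
    (∀ i (m : ℕ) → Odd m → m < g → ¬ HasOrCycle (IG (S i)) m) →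
    -- (iii)
    (∀ i (v : Fin (size (S i))) → OnOrCycle (IG (S i)) v g) →
    -- (v)
    (∀ i (m : ℕ) → OrPath (IG (S i)) (outS (S i)) (inS (S i)) m → Odd m → g ≤ m) →
    -- (iv) gives equivalence with the šíp product category
    ((∀ i (m : ℕ) → BiPath (IG (S i)) (outS (S i)) (inS (S i)) m → 3 ≤ m) →
       Equivalent (SipCat S))
    ×
    -- (iv') gives equivalence with the directed product category
    ((∀ i (m : ℕ) → DirPath (IG (S i)) (outS (S i)) (inS (S i)) m → 3 ≤ m) →
       Equivalent (VecCat S))
lemma4p3 k _ S connected rigid g g-odd _ odd-girth on-g-cycle odd-paths =
  (λ bi-long → Fullness.equivalence (sip-arcs S) connected rigid g-odd on-g-cycle
                 terminal-walks-long (sip-base-not-sent-into-copy S bi-long)) ,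
  (λ di-long → Fullness.equivalence (vec-arcs S) connected rigid g-odd on-g-cycle
                 terminal-walks-long (vec-base-not-sent-into-copy S di-long))
  where
  terminal-walks-long : ∀ i → OddTerminalWalksLong (S i) g
  terminal-walks-long i = g≤odd-terminal-walk (S i) (odd-girth i) (odd-paths i)
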